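{- Let $n \ge 1$ be an integer and let \[ K := \left\{ (x_1, \dots , x_n) \in \mathbb{R}_{ >0 }^n : \, x_j \le x_1 + \dots + \widehat{ x_j } + \dots + x_n \ \text{ for all } \ 1 \le j \le n \right\}, \] where $\widehat{x_j}$ means that the term $x_j$ is omitted. Then, as formal power series (equivalently, rational functions) in $z_1,\dots,z_n$, \[ \sum_{\mathbf m \in K \cap \mathbb{Z}^n} z_1^{m_1}\cdots z_n^{m_n} = \frac{ z_1 \cdots z_n }{ (1-z_1) \cdots (1-z_n) } - \sum_{ k=1 }^n \frac{ z_1 \cdots z_{ k-1 } z_k^n z_{ k+1 } \cdots z_n }{ (1-z_k) \prod_{ j=1,\, j \ne k }^n (1 - z_k z_j) } . \] -}

module Defs where

open import Data.Nat as ℕ using (ℕ; zero; suc; _≤_; _∸_)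
import Data.Nat.Properties as ℕP
open import Data.Integer as ℤ using (ℤ; 0ℤ; 1ℤ)
open import Data.Fin using (Fin)
import Data.Fin.Properties as FinP
open import Data.Bool using (Bool; true; false; if_then_else_)
open import Data.Product using (_×_)

import Data.List as L
import Data.Nat.ListAction as NLA
open import Data.List using (List; []; _∷_)
open import Data.Vec as V using (Vec; []; _∷_; lookup; replicate; zipWith; _[_]≔_)
import Data.Vec.Properties as VP
open import Relation.Nullary using (Dec; yes; no; ¬_; ¬?; _×-dec_)
open import Relation.Nullary.Decidable using (⌊_⌋)
open import Relation.Binary.PropositionalEquality using (_≡_)

-- Formal power series in n variables z_1..z_n with integer coefficients:
-- a series is its coefficient function on exponent vectors m ∈ ℕ^n.

Exp : ℕ → Set
Exp n = Vec ℕ n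

PS : ℕ → Set
PS n = Exp n → ℤ

sumℤ : List ℤ → ℤ
sumℤ = L.foldr ℤ._+_ 0ℤ

box : ∀ {n} → Exp n → List (Exp n)
box []       = [] ∷ []
box (x ∷ xs) = L.concatMap (λ i → L.map (i ∷_) (box xs)) (L.upTo (suc x))

_-ᵉ_ : ∀ {n} → Exp n → Exp n → Exp n
_-ᵉ_ = zipWith _∸_

_+ᵉ_ : ∀ {n} → Exp n → Exp n → Exp n
_+ᵉ_ = zipWith ℕ._+_

_⋆_ : ∀ {n} → PS n → PS n → PS n
(f ⋆ g) m = sumℤ (L.map (λ a → f a ℤ.* g (m -ᵉ a)) (box m))

_⊕_ : ∀ {n} → PS n → PS n → PS n
(f ⊕ g) m = f m ℤ.+ g m

_⊖_ : ∀ {n} → PS n → PS n → PS n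
(f ⊖ g) m = f m ℤ.- g m

zeroPS : ∀ {n} → PS n
zeroPS _ = 0ℤ

mono : ∀ {n} → Exp n → PS n
mono e m = if ⌊ VP.≡-dec ℕP._≟_ m e ⌋ then 1ℤ else 0ℤ

onePS : ∀ {n} → PS n
onePS {n} = mono (replicate n 0)

_·ᵉ_ : ∀ {n} → ℕ → Exp n → Exp n
t ·ᵉ e = V.map (t ℕ.*_) e

deg : ∀ {n} → Exp n → ℕ
deg = V.foldr _ ℕ._+_ 0

-- The expansion of 1/(1 - z^e) for a nonzero exponent vector e:
-- the geometric series  Σ_{t ≥ 0} z^{t e}.  Its coefficient at m is the
-- number of t with t·e = m; for e ≠ 0 any such t satisfies t ≤ deg m,
-- so it suffices to range over t = 0 .. deg m.
geom : ∀ {n} → Exp n → PS n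
geom e m = sumℤ (L.map (λ t → mono (t ·ᵉ e) m) (L.upTo (suc (deg m))))

prodPS : ∀ {n} → List (PS n) → PS n
prodPS = L.foldr _⋆_ onePS

sumPS : ∀ {n} → List (PS n) → PS n
sumPS = L.foldr _⊕_ zeroPS

unit : ∀ {n} → Fin n → Exp n
unit {n} k = replicate n 0 [ k ]≔ 1

ones : ∀ n → Exp n
ones n = replicate n 1

numExp : ∀ n → Fin n → Exp n
numExp n k = ones n [ k ]≔ n

others : ∀ n → Fin n → List (Fin n)
others n k = L.filter (λ j → ¬? (j FinP.≟ k)) (L.allFin n)

sumExcept : ∀ {n} → Exp n → Fin n → ℕ
sumExcept {n} m j = NLA.sum (L.map (lookup m) (others n j))

-- m ∈ K ∩ ℤ^n : all coordinates positive (for integers, ≥ 1) and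
-- m_j ≤ Σ_{i ≠ j} m_i for every j.
InK : ∀ {n} → Exp n → Set
InK m = ∀ j → (1 ≤ lookup m j) × (lookup m j ≤ sumExcept m j)

InK? : ∀ {n} (m : Exp n) → Dec (InK m)
InK? m = FinP.all? (λ j → (1 ℕP.≤? lookup m j) ×-dec (lookup m j ℕP.≤? sumExcept m j))

lhsSeries : ∀ n → PS n
lhsSeries n m = if ⌊ InK? m ⌋ then 1ℤ else 0ℤ

firstTerm : ∀ n → PS n
firstTerm n = mono (ones n) ⋆ prodPS (L.map (λ j → geom (unit j)) (L.allFin n))

kTerm : ∀ n → Fin n → PS n
kTerm n k = mono (numExp n k) ⋆ (geom (unit k)
              ⋆ prodPS (L.map (λ j → geom (unit k +ᵉ unit j)) (others n k)))

rhsSeries : ∀ n → PS n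
rhsSeries n = firstTerm n ⊖ sumPS (L.map (kTerm n) (L.allFin n))

-- Every factor 1/(1 - z^e) is expanded as a geometric series, so all coefficients are
-- Iverson brackets. z_1⋯z_n/∏(1 - z_j) is the indicator of m ≥ 1. The denominator
-- (1 - z_k) ∏_{j≠k} (1 - z_k z_j) generates each exponent m' with m'_k ≥ Σ_{j≠k} m'_j exactly
-- once (z_k z_j is used m'_j times, z_k the remaining times), so after the shift by the
-- numerator the k-th term is the indicator of {m ≥ 1, m_k > Σ_{j≠k} m_j}. At most one k
-- can satisfy m_k > Σ_{j≠k} m_j, and m ∈ K iff m ≥ 1 and none does; hence the
-- right-hand side is [m ≥ 1] - Σ_k [m ≥ 1, m_k > Σ_{j≠k} m_j] = [m ∈ K].

module Submission where

open import Defs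
open import Data.Nat using (ℕ; zero; suc; _+_; _*_; _∸_; _≤_; _<_; z≤n; s≤s)
import Data.Nat.Properties as ℕP
import Data.Nat.ListAction as NLA
open import Data.Integer using (ℤ; 0ℤ; 1ℤ) renaming (_+_ to _+ℤ_; _*_ to _*ℤ_; _-_ to _-ℤ_)
import Data.Integer.Properties as ℤP
open import Algebra.Properties.CommutativeSemigroup ℤP.+-commutativeSemigroup using () renaming (interchange to +-interchange)
open import Data.Fin as F using (Fin)
import Data.Fin.Properties as FinP
open import Data.Bool using (if_then_else_)
open import Data.Product using (_×_; _,_; proj₁; proj₂; ∃)
import Data.List as L
open import Data.List using (List; []; _∷_)
import Data.List.Properties as LP
open import Data.List.Membership.Propositional using (_∈_; _∉_)
import Data.List.Membership.Propositional.Properties as MP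
open import Data.List.Relation.Unary.Any using (here; there; any?)
import Data.List.Relation.Unary.All as All
open import Data.List.Relation.Unary.Unique.Propositional using (Unique)
import Data.List.Relation.Unary.Unique.Propositional.Properties as UP
open import Data.List.Relation.Unary.AllPairs using (_∷_)
open import Data.Vec using ([]; _∷_; lookup; replicate)
import Data.Vec.Properties as VP
open import Relation.Nullary using (Dec; yes; no; ¬_; ¬?; _×-dec_; _→-dec_)
open import Relation.Nullary.Decidable using (⌊_⌋)
open import Relation.Binary.PropositionalEquality
open import Data.Empty using (⊥-elim)
open import Function using (_∘_)

guard : ∀ {p} {P : Set p} → Dec P → ℤ → ℤ
guard d x = if ⌊ d ⌋ then x else 0ℤ

guard-yes : ∀ {p} {P : Set p} (d : Dec P) {x} → P → guard d x ≡ x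
guard-yes (yes _) _ = refl
guard-yes (no ¬p) p = ⊥-elim (¬p p)

guard-no : ∀ {p} {P : Set p} (d : Dec P) {x} → ¬ P → guard d x ≡ 0ℤ
guard-no (yes p) ¬p = ⊥-elim (¬p p)
guard-no (no _)  _  = refl

guard-⇔ : ∀ {p q} {P : Set p} {Q : Set q} (d : Dec P) (e : Dec Q) {x} →
          (P → Q) → (Q → P) → guard d x ≡ guard e x
guard-⇔ (yes _) (yes _) _  _    = refl
guard-⇔ (yes p) (no ¬q) to _    = ⊥-elim (¬q (to p))
guard-⇔ (no ¬p) (yes q) _  from = ⊥-elim (¬p (from q))
guard-⇔ (no _)  (no _)  _  _    = refl

guard-× : ∀ {p q} {P : Set p} {Q : Set q} (d : Dec P) (e : Dec Q) {x} →
          guard d (guard e x) ≡ guard (d ×-dec e) x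
guard-× (yes _) (yes _) = refl
guard-× (yes _) (no _)  = refl
guard-× (no _)  _       = refl

guard-1-* : ∀ {p} {P : Set p} (d : Dec P) x → guard d 1ℤ *ℤ x ≡ guard d x
guard-1-* (yes _) x = ℤP.*-identityˡ x
guard-1-* (no _)  x = ℤP.*-zeroˡ x

guard-congʳ : ∀ {p} {P : Set p} (d : Dec P) {x y} → (P → x ≡ y) → guard d x ≡ guard d y
guard-congʳ (yes p) x≡y = x≡y p
guard-congʳ (no _)  x≡y = refl

∑ : ∀ {A : Set} → List A → (A → ℤ) → ℤ
∑ xs f = sumℤ (L.map f xs)

∑-cong : ∀ {A : Set} (xs : List A) {f g : A → ℤ} → (∀ a → f a ≡ g a) → ∑ xs f ≡ ∑ xs g
∑-cong xs f≗g = cong sumℤ (LP.map-cong f≗g xs)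

∑-zeros : ∀ {A : Set} (xs : List A) {f : A → ℤ} → (∀ a → f a ≡ 0ℤ) → ∑ xs f ≡ 0ℤ
∑-zeros []       f≡0 = refl
∑-zeros (x ∷ xs) f≡0 = cong₂ _+ℤ_ (f≡0 x) (∑-zeros xs f≡0)

∑-+ : ∀ {A : Set} (xs : List A) (f g : A → ℤ) → ∑ xs (λ a → f a +ℤ g a) ≡ ∑ xs f +ℤ ∑ xs g
∑-+ []       f g = refl
∑-+ (x ∷ xs) f g = trans (cong ((f x +ℤ g x) +ℤ_) (∑-+ xs f g)) (+-interchange (f x) (g x) (∑ xs f) (∑ xs g))

∑-guard : ∀ {A : Set} {p} {P : Set p} (d : Dec P) (xs : List A) (f : A → ℤ) →
          ∑ xs (λ a → guard d (f a)) ≡ guard d (∑ xs f)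
∑-guard (yes _) xs f = refl
∑-guard (no _)  xs f = ∑-zeros xs (λ _ → refl)

∑-++ : ∀ {A : Set} (xs ys : List A) (f : A → ℤ) → ∑ (xs L.++ ys) f ≡ ∑ xs f +ℤ ∑ ys f
∑-++ []       ys f = sym (ℤP.+-identityˡ _)
∑-++ (x ∷ xs) ys f = trans (cong (f x +ℤ_) (∑-++ xs ys f)) (sym (ℤP.+-assoc (f x) _ _))

∑-concatMap : ∀ {A B : Set} (xs : List A) (g : A → List B) (f : B → ℤ) →
              ∑ (L.concatMap g xs) f ≡ ∑ xs (λ x → ∑ (g x) f)
∑-concatMap []       g f = refl
∑-concatMap (x ∷ xs) g f =
  trans (∑-++ (g x) (L.concatMap g xs) f) (cong (∑ (g x) f +ℤ_) (∑-concatMap xs g f))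

∑-map : ∀ {A B : Set} (xs : List A) (g : A → B) (f : B → ℤ) → ∑ (L.map g xs) f ≡ ∑ xs (f ∘ g)
∑-map xs g f = cong sumℤ (sym (LP.map-∘ xs))

∑-allFin-suc : ∀ n (f : Fin (suc n) → ℤ) → ∑ (L.allFin (suc n)) f ≡ f F.zero +ℤ ∑ (L.allFin n) (f ∘ F.suc)
∑-allFin-suc n f = cong (f F.zero +ℤ_) (cong sumℤ
  (trans (LP.map-tabulate F.suc f) (sym (LP.map-tabulate (λ i → i) (f ∘ F.suc)))))

∑-allFin-delta : ∀ n (c : Fin n) (f : Fin n → ℤ) → ∑ (L.allFin n) (λ i → guard (i FinP.≟ c) (f i)) ≡ f c
∑-allFin-delta (suc n) F.zero f = begin
  ∑ (L.allFin (suc n)) (λ i → guard (i FinP.≟ F.zero) (f i))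
    ≡⟨ ∑-allFin-suc n (λ i → guard (i FinP.≟ F.zero) (f i)) ⟩
  f F.zero +ℤ ∑ (L.allFin n) (λ i → guard (F.suc i FinP.≟ F.zero) (f (F.suc i)))
    ≡⟨ cong (f F.zero +ℤ_) (∑-zeros (L.allFin n) (λ _ → refl)) ⟩
  f F.zero +ℤ 0ℤ
    ≡⟨ ℤP.+-identityʳ (f F.zero) ⟩
  f F.zero ∎
  where open ≡-Reasoning
∑-allFin-delta (suc n) (F.suc c) f = begin
  ∑ (L.allFin (suc n)) (λ i → guard (i FinP.≟ F.suc c) (f i))
    ≡⟨ ∑-allFin-suc n (λ i → guard (i FinP.≟ F.suc c) (f i)) ⟩
  0ℤ +ℤ ∑ (L.allFin n) (λ i → guard (F.suc i FinP.≟ F.suc c) (f (F.suc i)))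
    ≡⟨ ℤP.+-identityˡ _ ⟩
  ∑ (L.allFin n) (λ i → guard (F.suc i FinP.≟ F.suc c) (f (F.suc i)))
    ≡⟨ ∑-cong (L.allFin n) (λ i → guard-⇔ (F.suc i FinP.≟ F.suc c) (i FinP.≟ c) FinP.suc-injective (cong F.suc)) ⟩
  ∑ (L.allFin n) (λ i → guard (i FinP.≟ c) (f (F.suc i)))
    ≡⟨ ∑-allFin-delta n c (f ∘ F.suc) ⟩
  f (F.suc c) ∎
  where open ≡-Reasoning

∑< : ℕ → (ℕ → ℤ) → ℤ
∑< zero    h = 0ℤ
∑< (suc N) h = h 0 +ℤ ∑< N (h ∘ suc)

∑-applyUpTo : ∀ (g : ℕ → ℕ) N (h : ℕ → ℤ) → ∑ (L.applyUpTo g N) h ≡ ∑< N (h ∘ g)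
∑-applyUpTo g zero    h = refl
∑-applyUpTo g (suc N) h = cong (h (g 0) +ℤ_) (∑-applyUpTo (g ∘ suc) N h)

∑-upTo : ∀ N (h : ℕ → ℤ) → ∑ (L.upTo N) h ≡ ∑< N h
∑-upTo = ∑-applyUpTo (λ t → t)

∑<-cong : ∀ N {h h′ : ℕ → ℤ} → (∀ t → t < N → h t ≡ h′ t) → ∑< N h ≡ ∑< N h′
∑<-cong zero    h≗h′ = refl
∑<-cong (suc N) h≗h′ = cong₂ _+ℤ_ (h≗h′ 0 (s≤s z≤n)) (∑<-cong N (λ t t<N → h≗h′ (suc t) (s≤s t<N)))

∑<-zeros : ∀ N {h : ℕ → ℤ} → (∀ t → h t ≡ 0ℤ) → ∑< N h ≡ 0ℤ
∑<-zeros zero    h≡0 = refl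
∑<-zeros (suc N) h≡0 = cong₂ _+ℤ_ (h≡0 0) (∑<-zeros N (h≡0 ∘ suc))

∑<-extend : ∀ {N N′} {h : ℕ → ℤ} → N ≤ N′ → (∀ t → N ≤ t → h t ≡ 0ℤ) → ∑< N′ h ≡ ∑< N h
∑<-extend {zero}  {N′}    z≤n       h≡0 = ∑<-zeros N′ (λ t → h≡0 t z≤n)
∑<-extend {suc N} {suc N′} {h} (s≤s N≤N′) h≡0 = cong (h 0 +ℤ_) (∑<-extend N≤N′ (λ t N≤t → h≡0 (suc t) (s≤s N≤t)))

∑<-*ʳ : ∀ N (h : ℕ → ℤ) x → ∑< N h *ℤ x ≡ ∑< N (λ t → h t *ℤ x)
∑<-*ʳ zero    h x = ℤP.*-zeroˡ x
∑<-*ʳ (suc N) h x =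
  trans (ℤP.*-distribʳ-+ x (h 0) (∑< N (h ∘ suc))) (cong (h 0 *ℤ x +ℤ_) (∑<-*ʳ N (h ∘ suc) x))

∑-∑< : ∀ {A : Set} (xs : List A) N (h : A → ℕ → ℤ) →
       ∑ xs (λ a → ∑< N (h a)) ≡ ∑< N (λ t → ∑ xs (λ a → h a t))
∑-∑< xs zero    h = ∑-zeros xs (λ _ → refl)
∑-∑< xs (suc N) h = trans (∑-+ xs (λ a → h a 0) (λ a → ∑< N (h a ∘ suc)))
                          (cong (∑ xs (λ a → h a 0) +ℤ_) (∑-∑< xs N (λ a → h a ∘ suc)))

∑<-delta : ∀ N c (h : ℕ → ℤ) → ∑< N (λ t → guard (t ℕP.≟ c) (h t)) ≡ guard (c ℕP.<? N) (h c)
∑<-delta zero    c       h = sym (guard-no (c ℕP.<? 0) {h c} (λ ()))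
∑<-delta (suc N) zero    h = begin
  h 0 +ℤ ∑< N (λ t → guard (suc t ℕP.≟ 0) (h (suc t))) ≡⟨ cong (h 0 +ℤ_) (∑<-zeros N (λ _ → refl)) ⟩
  h 0 +ℤ 0ℤ                                           ≡⟨ ℤP.+-identityʳ (h 0) ⟩
  h 0                                                  ≡⟨ guard-yes (0 ℕP.<? suc N) (s≤s z≤n) ⟨
  guard (0 ℕP.<? suc N) (h 0)                          ∎
  where open ≡-Reasoning
∑<-delta (suc N) (suc c) h = begin
  0ℤ +ℤ ∑< N (λ t → guard (suc t ℕP.≟ suc c) (h (suc t)))
    ≡⟨ ℤP.+-identityˡ _ ⟩
  ∑< N (λ t → guard (suc t ℕP.≟ suc c) (h (suc t)))
    ≡⟨ ∑<-cong N (λ t _ → guard-⇔ (suc t ℕP.≟ suc c) (t ℕP.≟ c) ℕP.suc-injective (cong suc)) ⟩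
  ∑< N (λ t → guard (t ℕP.≟ c) (h (suc t)))
    ≡⟨ ∑<-delta N c (h ∘ suc) ⟩
  guard (c ℕP.<? N) (h (suc c))
    ≡⟨ guard-⇔ (c ℕP.<? N) (suc c ℕP.<? suc N) s≤s ℕP.≤-pred ⟩
  guard (suc c ℕP.<? suc N) (h (suc c)) ∎
  where open ≡-Reasoning

∑<-unique : ∀ {p} {P : ℕ → Set p} (P? : ∀ t → Dec (P t)) N c →
            (∀ t → P t → t ≡ c) → c < N → ∑< N (λ t → guard (P? t) 1ℤ) ≡ guard (P? c) 1ℤ
∑<-unique P? N c unique c<N = begin
  ∑< N (λ t → guard (P? t) 1ℤ)                         ≡⟨ ∑<-cong N (λ t _ → only-c t) ⟩
  ∑< N (λ t → guard (t ℕP.≟ c) (guard (P? c) 1ℤ))      ≡⟨ ∑<-delta N c (λ _ → guard (P? c) 1ℤ) ⟩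
  guard (c ℕP.<? N) (guard (P? c) 1ℤ)                  ≡⟨ guard-yes (c ℕP.<? N) c<N ⟩
  guard (P? c) 1ℤ                                      ∎
  where
  open ≡-Reasoning
  only-c : ∀ t → guard (P? t) 1ℤ ≡ guard (t ℕP.≟ c) (guard (P? c) 1ℤ)
  only-c t with t ℕP.≟ c
  ... | yes refl = refl
  ... | no t≢c   = guard-no (P? t) (t≢c ∘ unique t)

infix 4 _≤ᵉ_ _≤ᵉ?_ _≟ᵉ_

_≤ᵉ_ : ∀ {n} → Exp n → Exp n → Set
a ≤ᵉ m = ∀ i → lookup a i ≤ lookup m i

_≤ᵉ?_ : ∀ {n} (a m : Exp n) → Dec (a ≤ᵉ m)
a ≤ᵉ? m = FinP.all? (λ i → lookup a i ℕP.≤? lookup m i)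

_≟ᵉ_ : ∀ {n} (a e : Exp n) → Dec (a ≡ e)
_≟ᵉ_ = VP.≡-dec ℕP._≟_

∷-≤ᵉ : ∀ {n} {i x} {a xs : Exp n} → i ≤ x → a ≤ᵉ xs → i ∷ a ≤ᵉ x ∷ xs
∷-≤ᵉ i≤x a≤xs F.zero    = i≤x
∷-≤ᵉ i≤x a≤xs (F.suc j) = a≤xs j

≡-lookup : ∀ {n} {u v : Exp n} → (∀ i → lookup u i ≡ lookup v i) → u ≡ v
≡-lookup {u = u} {v} eq =
  trans (sym (VP.tabulate∘lookup u)) (trans (VP.tabulate-cong eq) (VP.tabulate∘lookup v))

lookup-+ᵉ : ∀ {n} (a b : Exp n) i → lookup (a +ᵉ b) i ≡ lookup a i + lookup b i
lookup-+ᵉ a b i = VP.lookup-zipWith _+_ i a b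

lookup--ᵉ : ∀ {n} (a b : Exp n) i → lookup (a -ᵉ b) i ≡ lookup a i ∸ lookup b i
lookup--ᵉ a b i = VP.lookup-zipWith _∸_ i a b

lookup-·ᵉ : ∀ {n} t (a : Exp n) i → lookup (t ·ᵉ a) i ≡ t * lookup a i
lookup-·ᵉ t a i = VP.lookup-map i (t *_) a

lookup-unit-≡ : ∀ {n} (j : Fin n) → lookup (unit j) j ≡ 1
lookup-unit-≡ {n} j = VP.lookup∘update j (replicate n 0) 1

lookup-unit-≢ : ∀ {n} {i j : Fin n} → i ≢ j → lookup (unit j) i ≡ 0
lookup-unit-≢ {n} {i} i≢j = trans (VP.lookup∘update′ i≢j (replicate n 0) 1) (VP.lookup-replicate i 0)

lookup-ones : ∀ {n} (i : Fin n) → lookup (ones n) i ≡ 1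
lookup-ones i = VP.lookup-replicate i 1

deg-·ᵉ : ∀ {n} t (a : Exp n) → deg (t ·ᵉ a) ≡ t * deg a
deg-·ᵉ t []       = sym (ℕP.*-zeroʳ t)
deg-·ᵉ t (x ∷ xs) = trans (cong (t * x +_) (deg-·ᵉ t xs)) (sym (ℕP.*-distribˡ-+ t x (deg xs)))

deg-mono-≤ : ∀ {n} {a m : Exp n} → a ≤ᵉ m → deg a ≤ deg m
deg-mono-≤ {a = []}    {[]}    a≤m = z≤n
deg-mono-≤ {a = _ ∷ a} {_ ∷ m} a≤m = ℕP.+-mono-≤ (a≤m F.zero) (deg-mono-≤ {a = a} {m} (a≤m ∘ F.suc))

lookup≤deg : ∀ {n} (a : Exp n) i → lookup a i ≤ deg a
lookup≤deg (x ∷ a) F.zero    = ℕP.m≤m+n x (deg a)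
lookup≤deg (x ∷ a) (F.suc i) = ℕP.≤-trans (lookup≤deg a i) (ℕP.m≤n+m (deg a) x)

∑-box-∷ : ∀ {n} x (xs : Exp n) (h : Exp (suc n) → ℤ) →
          ∑ (box (x ∷ xs)) h ≡ ∑< (suc x) (λ i → ∑ (box xs) (λ a → h (i ∷ a)))
∑-box-∷ x xs h = begin
  ∑ (L.concatMap (λ i → L.map (i ∷_) (box xs)) (L.upTo (suc x))) h
    ≡⟨ ∑-concatMap (L.upTo (suc x)) (λ i → L.map (i ∷_) (box xs)) h ⟩
  ∑ (L.upTo (suc x)) (λ i → ∑ (L.map (i ∷_) (box xs)) h)
    ≡⟨ ∑-cong (L.upTo (suc x)) (λ i → ∑-map (box xs) (i ∷_) h) ⟩
  ∑ (L.upTo (suc x)) (λ i → ∑ (box xs) (λ a → h (i ∷ a)))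
    ≡⟨ ∑-upTo (suc x) (λ i → ∑ (box xs) (λ a → h (i ∷ a))) ⟩
  ∑< (suc x) (λ i → ∑ (box xs) (λ a → h (i ∷ a))) ∎
  where open ≡-Reasoning

∑-box-cong : ∀ {n} (m : Exp n) {h h′ : Exp n → ℤ} → (∀ a → a ≤ᵉ m → h a ≡ h′ a) → ∑ (box m) h ≡ ∑ (box m) h′
∑-box-cong []       h≗h′ = cong (_+ℤ 0ℤ) (h≗h′ [] (λ ()))
∑-box-cong (x ∷ xs) {h} {h′} h≗h′ = begin
  ∑ (box (x ∷ xs)) h
    ≡⟨ ∑-box-∷ x xs h ⟩
  ∑< (suc x) (λ i → ∑ (box xs) (λ a → h (i ∷ a)))
    ≡⟨ ∑<-cong (suc x) (λ i i≤x → ∑-box-cong xs (λ a a≤xs → h≗h′ (i ∷ a) (∷-≤ᵉ (ℕP.≤-pred i≤x) a≤xs))) ⟩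
  ∑< (suc x) (λ i → ∑ (box xs) (λ a → h′ (i ∷ a)))
    ≡⟨ ∑-box-∷ x xs h′ ⟨
  ∑ (box (x ∷ xs)) h′ ∎
  where open ≡-Reasoning

∑-box-delta : ∀ {n} (m e : Exp n) (g : Exp n → ℤ) → ∑ (box m) (λ a → guard (a ≟ᵉ e) (g a)) ≡ guard (e ≤ᵉ? m) (g e)
∑-box-delta []       []       g = trans (ℤP.+-identityʳ (g [])) (sym (guard-yes ([] ≤ᵉ? []) (λ ())))
∑-box-delta (x ∷ xs) (e ∷ es) g = begin
  ∑ (box (x ∷ xs)) (λ a → guard (a ≟ᵉ e ∷ es) (g a))
    ≡⟨ ∑-box-∷ x xs _ ⟩
  ∑< (suc x) (λ i → ∑ (box xs) (λ a → guard (i ∷ a ≟ᵉ e ∷ es) (g (i ∷ a))))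
    ≡⟨ ∑<-cong (suc x) (λ i _ → inner i) ⟩
  ∑< (suc x) (λ i → guard (i ℕP.≟ e) (guard (es ≤ᵉ? xs) (g (i ∷ es))))
    ≡⟨ ∑<-delta (suc x) e (λ i → guard (es ≤ᵉ? xs) (g (i ∷ es))) ⟩
  guard (e ℕP.<? suc x) (guard (es ≤ᵉ? xs) (g (e ∷ es)))
    ≡⟨ guard-× (e ℕP.<? suc x) (es ≤ᵉ? xs) ⟩
  guard ((e ℕP.<? suc x) ×-dec (es ≤ᵉ? xs)) (g (e ∷ es))
    ≡⟨ guard-⇔ ((e ℕP.<? suc x) ×-dec (es ≤ᵉ? xs)) (e ∷ es ≤ᵉ? x ∷ xs)
         (λ (e<x , es≤xs) → ∷-≤ᵉ (ℕP.≤-pred e<x) es≤xs) (λ le → s≤s (le F.zero) , le ∘ F.suc) ⟩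
  guard (e ∷ es ≤ᵉ? x ∷ xs) (g (e ∷ es)) ∎
  where
  open ≡-Reasoning
  inner : ∀ i → ∑ (box xs) (λ a → guard (i ∷ a ≟ᵉ e ∷ es) (g (i ∷ a)))
              ≡ guard (i ℕP.≟ e) (guard (es ≤ᵉ? xs) (g (i ∷ es)))
  inner i = begin
    ∑ (box xs) (λ a → guard (i ∷ a ≟ᵉ e ∷ es) (g (i ∷ a)))
      ≡⟨ ∑-cong (box xs) (λ a → trans
           (guard-⇔ (i ∷ a ≟ᵉ e ∷ es) ((i ℕP.≟ e) ×-dec (a ≟ᵉ es))
             (λ eq → VP.∷-injectiveˡ eq , VP.∷-injectiveʳ eq) (λ (p , q) → cong₂ _∷_ p q))
           (sym (guard-× (i ℕP.≟ e) (a ≟ᵉ es)))) ⟩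
    ∑ (box xs) (λ a → guard (i ℕP.≟ e) (guard (a ≟ᵉ es) (g (i ∷ a))))
      ≡⟨ ∑-guard (i ℕP.≟ e) (box xs) _ ⟩
    guard (i ℕP.≟ e) (∑ (box xs) (λ a → guard (a ≟ᵉ es) (g (i ∷ a))))
      ≡⟨ cong (guard (i ℕP.≟ e)) (∑-box-delta xs es (λ a → g (i ∷ a))) ⟩
    guard (i ℕP.≟ e) (guard (es ≤ᵉ? xs) (g (i ∷ es))) ∎

⋆-congʳ : ∀ {n} (f : PS n) {g g′ : PS n} → (∀ a → g a ≡ g′ a) → ∀ m → (f ⋆ g) m ≡ (f ⋆ g′) m
⋆-congʳ f g≗g′ m = ∑-cong (box m) (λ a → cong (f a *ℤ_) (g≗g′ (m -ᵉ a)))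

mono-⋆ : ∀ {n} (e : Exp n) (f : PS n) m → (mono e ⋆ f) m ≡ guard (e ≤ᵉ? m) (f (m -ᵉ e))
mono-⋆ e f m = trans (∑-cong (box m) (λ a → guard-1-* (a ≟ᵉ e) (f (m -ᵉ a))))
                     (∑-box-delta m e (λ a → f (m -ᵉ a)))

t≤deg[t·ᵉe] : ∀ {n} t (e : Exp n) → 1 ≤ deg e → t ≤ deg (t ·ᵉ e)
t≤deg[t·ᵉe] t e 1≤deg-e = begin
  t              ≡⟨ ℕP.*-identityʳ t ⟨
  t * 1          ≤⟨ ℕP.*-monoʳ-≤ t 1≤deg-e ⟩
  t * deg e      ≡⟨ deg-·ᵉ t e ⟨
  deg (t ·ᵉ e)   ∎
  where open ℕP.≤-Reasoning

-- geom e a only sums t ≤ deg a; as deg e ≥ 1 no larger t has t·e = a, so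
-- every geom e a with a ≤ m may be summed up to deg m, and the sums swap.
geom-⋆ : ∀ {n} (e : Exp n) (f : PS n) m → 1 ≤ deg e →
         (geom e ⋆ f) m ≡ ∑< (suc (deg m)) (λ t → guard (t ·ᵉ e ≤ᵉ? m) (f (m -ᵉ (t ·ᵉ e))))
geom-⋆ e f m 1≤deg-e = begin
  ∑ (box m) (λ a → geom e a *ℤ f (m -ᵉ a))
    ≡⟨ ∑-box-cong m geom-term ⟩
  ∑ (box m) (λ a → ∑< (suc (deg m)) (λ t → guard (a ≟ᵉ t ·ᵉ e) (f (m -ᵉ a))))
    ≡⟨ ∑-∑< (box m) (suc (deg m)) (λ a t → guard (a ≟ᵉ t ·ᵉ e) (f (m -ᵉ a))) ⟩
  ∑< (suc (deg m)) (λ t → ∑ (box m) (λ a → guard (a ≟ᵉ t ·ᵉ e) (f (m -ᵉ a))))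
    ≡⟨ ∑<-cong (suc (deg m)) (λ t _ → ∑-box-delta m (t ·ᵉ e) (λ a → f (m -ᵉ a))) ⟩
  ∑< (suc (deg m)) (λ t → guard (t ·ᵉ e ≤ᵉ? m) (f (m -ᵉ (t ·ᵉ e)))) ∎
  where
  open ≡-Reasoning
  large-multiple : ∀ a t → suc (deg a) ≤ t → mono (t ·ᵉ e) a ≡ 0ℤ
  large-multiple a t deg-a<t = guard-no (a ≟ᵉ t ·ᵉ e) λ a≡te →
    ℕP.<⇒≱ deg-a<t (subst (λ b → t ≤ deg b) (sym a≡te) (t≤deg[t·ᵉe] t e 1≤deg-e))
  geom-term : ∀ a → a ≤ᵉ m →
    geom e a *ℤ f (m -ᵉ a) ≡ ∑< (suc (deg m)) (λ t → guard (a ≟ᵉ t ·ᵉ e) (f (m -ᵉ a)))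
  geom-term a a≤m = begin
    geom e a *ℤ f (m -ᵉ a)
      ≡⟨ cong (_*ℤ f (m -ᵉ a)) (∑-upTo (suc (deg a)) (λ t → mono (t ·ᵉ e) a)) ⟩
    ∑< (suc (deg a)) (λ t → mono (t ·ᵉ e) a) *ℤ f (m -ᵉ a)
      ≡⟨ cong (_*ℤ f (m -ᵉ a)) (∑<-extend (s≤s (deg-mono-≤ {a = a} {m} a≤m)) (large-multiple a)) ⟨
    ∑< (suc (deg m)) (λ t → mono (t ·ᵉ e) a) *ℤ f (m -ᵉ a)
      ≡⟨ ∑<-*ʳ (suc (deg m)) (λ t → mono (t ·ᵉ e) a) (f (m -ᵉ a)) ⟩
    ∑< (suc (deg m)) (λ t → mono (t ·ᵉ e) a *ℤ f (m -ᵉ a))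
      ≡⟨ ∑<-cong (suc (deg m)) (λ t _ → guard-1-* (a ≟ᵉ t ·ᵉ e) (f (m -ᵉ a))) ⟩
    ∑< (suc (deg m)) (λ t → guard (a ≟ᵉ t ·ᵉ e) (f (m -ᵉ a))) ∎

geom-⋆-unique : ∀ {n p} {P : Exp n → Set p} (P? : ∀ a → Dec (P a)) (e m : Exp n) (c : ℕ) → 1 ≤ deg e →
  (∀ t → t ·ᵉ e ≤ᵉ m → P (m -ᵉ (t ·ᵉ e)) → t ≡ c) → c ≤ deg m →
  (geom e ⋆ (λ a → guard (P? a) 1ℤ)) m ≡ guard ((c ·ᵉ e ≤ᵉ? m) ×-dec P? (m -ᵉ (c ·ᵉ e))) 1ℤ
geom-⋆-unique P? e m c 1≤deg-e unique c≤deg-m = begin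
  (geom e ⋆ (λ a → guard (P? a) 1ℤ)) m
    ≡⟨ geom-⋆ e (λ a → guard (P? a) 1ℤ) m 1≤deg-e ⟩
  ∑< (suc (deg m)) (λ t → guard (t ·ᵉ e ≤ᵉ? m) (guard (P? (m -ᵉ (t ·ᵉ e))) 1ℤ))
    ≡⟨ ∑<-cong (suc (deg m)) (λ t _ → guard-× (t ·ᵉ e ≤ᵉ? m) (P? (m -ᵉ (t ·ᵉ e))) {1ℤ}) ⟩
  ∑< (suc (deg m)) (λ t → guard ((t ·ᵉ e ≤ᵉ? m) ×-dec P? (m -ᵉ (t ·ᵉ e))) 1ℤ)
    ≡⟨ ∑<-unique (λ t → (t ·ᵉ e ≤ᵉ? m) ×-dec P? (m -ᵉ (t ·ᵉ e))) (suc (deg m)) c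
         (λ t (te≤m , p) → unique t te≤m p) (s≤s c≤deg-m) ⟩
  guard ((c ·ᵉ e ≤ᵉ? m) ×-dec P? (m -ᵉ (c ·ᵉ e))) 1ℤ ∎
  where open ≡-Reasoning

coordSum : ∀ {n} → List (Fin n) → Exp n → ℕ
coordSum S m = NLA.sum (L.map (lookup m) S)

sum-map-cong-∈ : ∀ {A : Set} (xs : List A) (f g : A → ℕ) →
                 (∀ x → x ∈ xs → f x ≡ g x) → NLA.sum (L.map f xs) ≡ NLA.sum (L.map g xs)
sum-map-cong-∈ xs f g eq = cong NLA.sum (LP.map-cong-local (All.tabulate (λ {x} → eq x)))

geomProduct : ∀ {n} → Exp n → List (Fin n) → PS n
geomProduct b S = prodPS (L.map (λ j → geom (b +ᵉ unit j)) S)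

-- When b vanishes on S, a decomposition m = Σ_{j ∈ S} c_j (b + e_j) forces c_j = m_j,
-- so m lies in the monoid generated by the b + e_j iff this holds.
SpannedBy : ∀ {n} → Exp n → List (Fin n) → Exp n → Set
SpannedBy b S m = ∀ i → i ∉ S → lookup m i ≡ coordSum S m * lookup b i

_∈?_ : ∀ {n} (i : Fin n) (S : List (Fin n)) → Dec (i ∈ S)
i ∈? S = any? (i FinP.≟_) S

SpannedBy? : ∀ {n} (b : Exp n) S m → Dec (SpannedBy b S m)
SpannedBy? b S m = FinP.all? (λ i → ¬? (i ∈? S) →-dec (lookup m i ℕP.≟ coordSum S m * lookup b i))

module PeelGenerator {n} (b : Exp n) (j : Fin n) (S : List (Fin n)) (j∉S : j ∉ S)
                     (b-zero : ∀ i → i ∈ j ∷ S → lookup b i ≡ 0) (m : Exp n) where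

  v : Exp n
  v = b +ᵉ unit j

  lookup-v-≢ : ∀ {i} → i ≢ j → lookup v i ≡ lookup b i
  lookup-v-≢ {i} i≢j = trans (lookup-+ᵉ b (unit j) i)
    (trans (cong (lookup b i +_) (lookup-unit-≢ i≢j)) (ℕP.+-identityʳ _))

  lookup-v-j : lookup v j ≡ 1
  lookup-v-j = trans (lookup-+ᵉ b (unit j) j) (cong₂ _+_ (b-zero j (here refl)) (lookup-unit-≡ j))

  lookup-v-S : ∀ {i} → i ∈ S → lookup v i ≡ 0
  lookup-v-S {i} i∈S = trans (lookup-v-≢ (λ { refl → j∉S i∈S })) (b-zero i (there i∈S))

  1≤deg-v : 1 ≤ deg v
  1≤deg-v = subst (_≤ deg v) lookup-v-j (lookup≤deg v j)

  lookup-t·v : ∀ t i → lookup (t ·ᵉ v) i ≡ t * lookup v i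
  lookup-t·v t = lookup-·ᵉ t v

  lookup-m-t·v : ∀ t i → lookup (m -ᵉ (t ·ᵉ v)) i ≡ lookup m i ∸ t * lookup v i
  lookup-m-t·v t i = trans (lookup--ᵉ m (t ·ᵉ v) i) (cong (lookup m i ∸_) (lookup-t·v t i))

  lookup-t·v-≢ : ∀ t {i} → i ≢ j → lookup (t ·ᵉ v) i ≡ t * lookup b i
  lookup-t·v-≢ t {i} i≢j = trans (lookup-t·v t i) (cong (t *_) (lookup-v-≢ i≢j))

  lookup-m-t·v-≢ : ∀ t {i} → i ≢ j → lookup (m -ᵉ (t ·ᵉ v)) i ≡ lookup m i ∸ t * lookup b i
  lookup-m-t·v-≢ t {i} i≢j = trans (lookup--ᵉ m (t ·ᵉ v) i) (cong (lookup m i ∸_) (lookup-t·v-≢ t i≢j))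

  t*v-j : ∀ t → t * lookup v j ≡ t
  t*v-j t = trans (cong (t *_) lookup-v-j) (ℕP.*-identityʳ t)

  coordSum-m-t·v : ∀ t → coordSum S (m -ᵉ (t ·ᵉ v)) ≡ coordSum S m
  coordSum-m-t·v t = sum-map-cong-∈ S (lookup (m -ᵉ (t ·ᵉ v))) (lookup m) λ i i∈S → trans (lookup-m-t·v t i)
    (trans (cong (λ x → lookup m i ∸ t * x) (lookup-v-S i∈S)) (cong (lookup m i ∸_) (ℕP.*-zeroʳ t)))

  c σ : ℕ
  c = lookup m j
  σ = coordSum S m

  unique : ∀ t → t ·ᵉ v ≤ᵉ m → SpannedBy b S (m -ᵉ (t ·ᵉ v)) → t ≡ c
  unique t t·v≤m spanned = ℕP.≤-antisym (subst (_≤ c) (trans (lookup-t·v t j) (t*v-j t)) (t·v≤m j))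
    (ℕP.m∸n≡0⇒m≤n (begin
      c ∸ t                                 ≡⟨ cong (c ∸_) (t*v-j t) ⟨
      c ∸ t * lookup v j                    ≡⟨ lookup-m-t·v t j ⟨
      lookup (m -ᵉ (t ·ᵉ v)) j              ≡⟨ spanned j j∉S ⟩
      coordSum S (m -ᵉ (t ·ᵉ v)) * lookup b j ≡⟨ cong (coordSum S (m -ᵉ (t ·ᵉ v)) *_) (b-zero j (here refl)) ⟩
      coordSum S (m -ᵉ (t ·ᵉ v)) * 0        ≡⟨ ℕP.*-zeroʳ (coordSum S (m -ᵉ (t ·ᵉ v))) ⟩
      0                                     ∎))
    where open ≡-Reasoning

  to : c ·ᵉ v ≤ᵉ m × SpannedBy b S (m -ᵉ (c ·ᵉ v)) → SpannedBy b (j ∷ S) m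
  to (c·v≤m , spanned) i i∉jS = begin
    lookup m i                                      ≡⟨ ℕP.m∸n+n≡m c*bᵢ≤mᵢ ⟨
    (lookup m i ∸ c * lookup b i) + c * lookup b i  ≡⟨ cong (_+ c * lookup b i) remainder ⟩
    σ * lookup b i + c * lookup b i                 ≡⟨ ℕP.+-comm (σ * lookup b i) _ ⟩
    c * lookup b i + σ * lookup b i                 ≡⟨ ℕP.*-distribʳ-+ (lookup b i) c σ ⟨
    (c + σ) * lookup b i                            ∎
    where
    open ≡-Reasoning
    i≢j : i ≢ j
    i≢j i≡j = i∉jS (here i≡j)
    c*bᵢ≤mᵢ : c * lookup b i ≤ lookup m i
    c*bᵢ≤mᵢ = subst (_≤ lookup m i) (lookup-t·v-≢ c i≢j) (c·v≤m i)
    remainder : lookup m i ∸ c * lookup b i ≡ σ * lookup b i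
    remainder = begin
      lookup m i ∸ c * lookup b i              ≡⟨ lookup-m-t·v-≢ c i≢j ⟨
      lookup (m -ᵉ (c ·ᵉ v)) i                 ≡⟨ spanned i (i∉jS ∘ there) ⟩
      coordSum S (m -ᵉ (c ·ᵉ v)) * lookup b i  ≡⟨ cong (_* lookup b i) (coordSum-m-t·v c) ⟩
      σ * lookup b i                           ∎

  from : SpannedBy b (j ∷ S) m → c ·ᵉ v ≤ᵉ m × SpannedBy b S (m -ᵉ (c ·ᵉ v))
  from spanned = c·v≤m , spanned′
    where
    open ≡-Reasoning
    lookup-m-≢ : ∀ {i} → i ≢ j → i ∉ S → lookup m i ≡ c * lookup b i + σ * lookup b i
    lookup-m-≢ {i} i≢j i∉S = trans (spanned i λ { (here i≡j) → i≢j i≡j ; (there i∈S) → i∉S i∈S })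
                                   (ℕP.*-distribʳ-+ (lookup b i) c σ)
    c·v≤m : c ·ᵉ v ≤ᵉ m
    c·v≤m i with i FinP.≟ j | i ∈? S
    ... | yes refl | _       = ℕP.≤-reflexive (trans (lookup-t·v c j) (t*v-j c))
    ... | no _     | yes i∈S = subst (_≤ lookup m i)
                                 (sym (trans (lookup-t·v c i) (trans (cong (c *_) (lookup-v-S i∈S)) (ℕP.*-zeroʳ c)))) z≤n
    ... | no i≢j   | no i∉S  = subst₂ _≤_ (sym (lookup-t·v-≢ c i≢j)) (sym (lookup-m-≢ i≢j i∉S)) (ℕP.m≤m+n _ _)
    spanned′ : SpannedBy b S (m -ᵉ (c ·ᵉ v))
    spanned′ i i∉S with i FinP.≟ j
    ... | yes refl = begin
      lookup (m -ᵉ (c ·ᵉ v)) j                 ≡⟨ lookup-m-t·v c j ⟩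
      c ∸ c * lookup v j                       ≡⟨ cong (c ∸_) (t*v-j c) ⟩
      c ∸ c                                    ≡⟨ ℕP.n∸n≡0 c ⟩
      0                                        ≡⟨ ℕP.*-zeroʳ (coordSum S (m -ᵉ (c ·ᵉ v))) ⟨
      coordSum S (m -ᵉ (c ·ᵉ v)) * 0           ≡⟨ cong (coordSum S (m -ᵉ (c ·ᵉ v)) *_) (b-zero j (here refl)) ⟨
      coordSum S (m -ᵉ (c ·ᵉ v)) * lookup b j  ∎
    ... | no i≢j = begin
      lookup (m -ᵉ (c ·ᵉ v)) i                            ≡⟨ lookup-m-t·v-≢ c i≢j ⟩
      lookup m i ∸ c * lookup b i                         ≡⟨ cong (_∸ c * lookup b i) (lookup-m-≢ i≢j i∉S) ⟩
      (c * lookup b i + σ * lookup b i) ∸ c * lookup b i  ≡⟨ ℕP.m+n∸m≡n (c * lookup b i) _ ⟩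
      σ * lookup b i                                      ≡⟨ cong (_* lookup b i) (coordSum-m-t·v c) ⟨
      coordSum S (m -ᵉ (c ·ᵉ v)) * lookup b i             ∎

geomProduct-coeff : ∀ {n} (b : Exp n) (S : List (Fin n)) → Unique S → (∀ i → i ∈ S → lookup b i ≡ 0) →
                    ∀ m → geomProduct b S m ≡ guard (SpannedBy? b S m) 1ℤ
geomProduct-coeff {n} b [] _ _ m =
  guard-⇔ (m ≟ᵉ replicate n 0) (SpannedBy? b [] m)
    (λ { refl i _ → VP.lookup-replicate i 0 })
    (λ spanned → ≡-lookup (λ i → trans (spanned i (λ ())) (sym (VP.lookup-replicate i 0))))
geomProduct-coeff b (j ∷ S) (j∉S ∷ unique-S) b-zero m = begin
  (geom v ⋆ geomProduct b S) m
    ≡⟨ ⋆-congʳ (geom v) (geomProduct-coeff b S unique-S (λ i → b-zero i ∘ there)) m ⟩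
  (geom v ⋆ (λ a → guard (SpannedBy? b S a) 1ℤ)) m
    ≡⟨ geom-⋆-unique (SpannedBy? b S) v m c 1≤deg-v unique (lookup≤deg m j) ⟩
  guard ((c ·ᵉ v ≤ᵉ? m) ×-dec SpannedBy? b S (m -ᵉ (c ·ᵉ v))) 1ℤ
    ≡⟨ guard-⇔ ((c ·ᵉ v ≤ᵉ? m) ×-dec SpannedBy? b S (m -ᵉ (c ·ᵉ v))) (SpannedBy? b (j ∷ S) m) to from ⟩
  guard (SpannedBy? b (j ∷ S) m) 1ℤ ∎
  where
  open ≡-Reasoning
  open PeelGenerator b j S (λ j∈S → All.lookup j∉S j∈S refl) b-zero m

∏-geom-unit-coeff : ∀ n (a : Exp n) → prodPS (L.map (λ j → geom (unit j)) (L.allFin n)) a ≡ 1ℤ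
∏-geom-unit-coeff n a = begin
  prodPS (L.map (λ j → geom (unit j)) (L.allFin n)) a
    ≡⟨ cong (λ fs → prodPS fs a) (LP.map-cong (λ j → cong geom (VP.zipWith-identityˡ ℕP.+-identityˡ (unit j))) (L.allFin n)) ⟨
  geomProduct (replicate n 0) (L.allFin n) a
    ≡⟨ geomProduct-coeff (replicate n 0) (L.allFin n) (UP.allFin⁺ n) (λ j _ → VP.lookup-replicate j 0) a ⟩
  guard (SpannedBy? (replicate n 0) (L.allFin n) a) 1ℤ
    ≡⟨ guard-yes (SpannedBy? (replicate n 0) (L.allFin n) a) (λ i i∉ → ⊥-elim (i∉ (MP.∈-allFin i))) ⟩
  1ℤ ∎
  where open ≡-Reasoning

firstTerm-coeff : ∀ n m → firstTerm n m ≡ guard (ones n ≤ᵉ? m) 1ℤ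
firstTerm-coeff n m = trans (mono-⋆ (ones n) (prodPS (L.map (λ j → geom (unit j)) (L.allFin n))) m)
                            (guard-congʳ (ones n ≤ᵉ? m) (λ _ → ∏-geom-unit-coeff n (m -ᵉ ones n)))

length-filter-≢ : ∀ {n} (k : Fin n) (xs : List (Fin n)) → Unique xs → k ∈ xs →
                  suc (L.length (L.filter (λ j → ¬? (j FinP.≟ k)) xs)) ≡ L.length xs
length-filter-≢ k (x ∷ xs) (x∉xs ∷ unique-xs) k∈x∷xs with x FinP.≟ k | k∈x∷xs
... | yes refl | _ = cong (suc ∘ L.length)
  (LP.filter-all (λ j → ¬? (j FinP.≟ k)) (All.map (λ x≢j j≡x → x≢j (sym j≡x)) x∉xs))
... | no x≢k | here k≡x   = ⊥-elim (x≢k (sym k≡x))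
... | no x≢k | there k∈xs = cong suc (length-filter-≢ k xs unique-xs k∈xs)

sum-map-∸1 : ∀ {A : Set} (f : A → ℕ) xs → (∀ i → i ∈ xs → 1 ≤ f i) →
             NLA.sum (L.map (λ i → f i ∸ 1) xs) + L.length xs ≡ NLA.sum (L.map f xs)
sum-map-∸1 f []       _   = refl
sum-map-∸1 f (x ∷ xs) pos = begin
  (f x ∸ 1 + ∑xs) + suc (L.length xs)   ≡⟨ ℕP.+-suc (f x ∸ 1 + ∑xs) (L.length xs) ⟩
  suc ((f x ∸ 1 + ∑xs) + L.length xs)   ≡⟨ cong suc (ℕP.+-assoc (f x ∸ 1) ∑xs (L.length xs)) ⟩
  suc (f x ∸ 1) + (∑xs + L.length xs)   ≡⟨ cong₂ _+_ (trans (ℕP.+-comm 1 _) (ℕP.m∸n+n≡m (pos x (here refl))))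
                                                     (sum-map-∸1 f xs (λ i → pos i ∘ there)) ⟩
  f x + NLA.sum (L.map f xs)            ∎
  where
  open ≡-Reasoning
  ∑xs : ℕ
  ∑xs = NLA.sum (L.map (λ i → f i ∸ 1) xs)

FailsAt : ∀ {n} → Exp n → Fin n → Set
FailsAt {n} m k = (ones n ≤ᵉ m) × (sumExcept m k < lookup m k)

FailsAt? : ∀ {n} (m : Exp n) k → Dec (FailsAt m k)
FailsAt? {n} m k = (ones n ≤ᵉ? m) ×-dec (sumExcept m k ℕP.<? lookup m k)

module KthTerm (n : ℕ) (k : Fin n) where

  S : List (Fin n)
  S = others n k

  ∈S⇒≢ : ∀ {j} → j ∈ S → j ≢ k
  ∈S⇒≢ j∈S = proj₂ (MP.∈-filter⁻ (λ j → ¬? (j FinP.≟ k)) {xs = L.allFin n} j∈S)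

  ≢⇒∈S : ∀ {j} → j ≢ k → j ∈ S
  ≢⇒∈S j≢k = MP.∈-filter⁺ (λ j → ¬? (j FinP.≟ k)) (MP.∈-allFin _) j≢k

  length-S : suc (L.length S) ≡ n
  length-S = trans (length-filter-≢ k (L.allFin n) (UP.allFin⁺ n) (MP.∈-allFin k)) (LP.length-tabulate (λ i → i))

  lookup-t·uₖ-k : ∀ t → lookup (t ·ᵉ unit k) k ≡ t
  lookup-t·uₖ-k t = trans (lookup-·ᵉ t (unit k) k) (trans (cong (t *_) (lookup-unit-≡ k)) (ℕP.*-identityʳ t))

  lookup-t·uₖ-≢ : ∀ t {i} → i ≢ k → lookup (t ·ᵉ unit k) i ≡ 0
  lookup-t·uₖ-≢ t {i} i≢k = trans (lookup-·ᵉ t (unit k) i) (trans (cong (t *_) (lookup-unit-≢ i≢k)) (ℕP.*-zeroʳ t))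

  lookup-a-t·uₖ-k : ∀ a t → lookup (a -ᵉ (t ·ᵉ unit k)) k ≡ lookup a k ∸ t
  lookup-a-t·uₖ-k a t = trans (lookup--ᵉ a (t ·ᵉ unit k) k) (cong (lookup a k ∸_) (lookup-t·uₖ-k t))

  coordSum-a-t·uₖ : ∀ a t → coordSum S (a -ᵉ (t ·ᵉ unit k)) ≡ coordSum S a
  coordSum-a-t·uₖ a t = sum-map-cong-∈ S (lookup (a -ᵉ (t ·ᵉ unit k))) (lookup a) λ i i∈S →
    trans (lookup--ᵉ a (t ·ᵉ unit k) i) (cong (lookup a i ∸_) (lookup-t·uₖ-≢ t (∈S⇒≢ i∈S)))

  geomProduct-S-coeff : ∀ a → geomProduct (unit k) S a ≡ guard (lookup a k ℕP.≟ coordSum S a) 1ℤ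
  geomProduct-S-coeff a = trans
    (geomProduct-coeff (unit k) S (UP.filter⁺ (λ j → ¬? (j FinP.≟ k)) (UP.allFin⁺ n)) (λ j → lookup-unit-≢ ∘ ∈S⇒≢) a)
    (guard-⇔ (SpannedBy? (unit k) S a) (lookup a k ℕP.≟ coordSum S a)
      (λ spanned → trans (spanned k (λ k∈S → ∈S⇒≢ k∈S refl)) σ*uₖₖ≡σ) from)
    where
    σ*uₖₖ≡σ : coordSum S a * lookup (unit k) k ≡ coordSum S a
    σ*uₖₖ≡σ = trans (cong (coordSum S a *_) (lookup-unit-≡ k)) (ℕP.*-identityʳ _)
    from : lookup a k ≡ coordSum S a → SpannedBy (unit k) S a
    from aₖ≡σ i i∉S with i FinP.≟ k
    ... | yes refl = trans aₖ≡σ (sym σ*uₖₖ≡σ)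
    ... | no i≢k   = ⊥-elim (i∉S (≢⇒∈S i≢k))

  denominator-coeff : ∀ a → (geom (unit k) ⋆ geomProduct (unit k) S) a ≡ guard (coordSum S a ℕP.≤? lookup a k) 1ℤ
  denominator-coeff a = begin
    (geom (unit k) ⋆ geomProduct (unit k) S) a
      ≡⟨ ⋆-congʳ (geom (unit k)) geomProduct-S-coeff a ⟩
    (geom (unit k) ⋆ (λ x → guard (P? x) 1ℤ)) a
      ≡⟨ geom-⋆-unique P? (unit k) a c 1≤deg-uₖ unique (ℕP.≤-trans (ℕP.m∸n≤m _ σ) (lookup≤deg a k)) ⟩
    guard ((c ·ᵉ unit k ≤ᵉ? a) ×-dec P? (a -ᵉ (c ·ᵉ unit k))) 1ℤ
      ≡⟨ guard-⇔ ((c ·ᵉ unit k ≤ᵉ? a) ×-dec P? (a -ᵉ (c ·ᵉ unit k))) (σ ℕP.≤? lookup a k) to from ⟩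
    guard (σ ℕP.≤? lookup a k) 1ℤ ∎
    where
    open ≡-Reasoning
    P? : ∀ x → Dec (lookup x k ≡ coordSum S x)
    P? x = lookup x k ℕP.≟ coordSum S x
    σ c : ℕ
    σ = coordSum S a
    c = lookup a k ∸ σ
    1≤deg-uₖ : 1 ≤ deg (unit k)
    1≤deg-uₖ = subst (_≤ deg (unit k)) (lookup-unit-≡ k) (lookup≤deg (unit k) k)
    aₖ∸t≡σ : ∀ t → lookup (a -ᵉ (t ·ᵉ unit k)) k ≡ coordSum S (a -ᵉ (t ·ᵉ unit k)) → lookup a k ∸ t ≡ σ
    aₖ∸t≡σ t eq = trans (sym (lookup-a-t·uₖ-k a t)) (trans eq (coordSum-a-t·uₖ a t))
    unique : ∀ t → t ·ᵉ unit k ≤ᵉ a → lookup (a -ᵉ (t ·ᵉ unit k)) k ≡ coordSum S (a -ᵉ (t ·ᵉ unit k)) → t ≡ c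
    unique t t·uₖ≤a eq = begin
      t                       ≡⟨ ℕP.m∸[m∸n]≡n (subst (_≤ lookup a k) (lookup-t·uₖ-k t) (t·uₖ≤a k)) ⟨
      lookup a k ∸ (lookup a k ∸ t) ≡⟨ cong (lookup a k ∸_) (aₖ∸t≡σ t eq) ⟩
      c                       ∎
    to : (c ·ᵉ unit k ≤ᵉ a) × (lookup (a -ᵉ (c ·ᵉ unit k)) k ≡ coordSum S (a -ᵉ (c ·ᵉ unit k))) → σ ≤ lookup a k
    to (_ , eq) = subst (_≤ lookup a k) (aₖ∸t≡σ c eq) (ℕP.m∸n≤m _ c)
    from : σ ≤ lookup a k → (c ·ᵉ unit k ≤ᵉ a) × (lookup (a -ᵉ (c ·ᵉ unit k)) k ≡ coordSum S (a -ᵉ (c ·ᵉ unit k)))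
    from σ≤aₖ = c·uₖ≤a , trans (lookup-a-t·uₖ-k a c) (trans (ℕP.m∸[m∸n]≡n σ≤aₖ) (sym (coordSum-a-t·uₖ a c)))
      where
      c·uₖ≤a : c ·ᵉ unit k ≤ᵉ a
      c·uₖ≤a i with i FinP.≟ k
      ... | yes refl = subst (_≤ lookup a k) (sym (lookup-t·uₖ-k c)) (ℕP.m∸n≤m _ σ)
      ... | no i≢k   = subst (_≤ lookup a i) (sym (lookup-t·uₖ-≢ c i≢k)) z≤n

  lookup-numExp-k : lookup (numExp n k) k ≡ n
  lookup-numExp-k = VP.lookup∘update k (ones n) n

  lookup-numExp-≢ : ∀ {i} → i ≢ k → lookup (numExp n k) i ≡ 1
  lookup-numExp-≢ {i} i≢k = trans (VP.lookup∘update′ i≢k (ones n) n) (lookup-ones i)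

  -- Subtracting numExp n k lowers each of the n - 1 coordinates in S by one.
  coordSum-m-numExp : ∀ m → (∀ i → 1 ≤ lookup m i) → coordSum S (m -ᵉ numExp n k) + n ≡ suc (sumExcept m k)
  coordSum-m-numExp m pos = begin
    coordSum S (m -ᵉ numExp n k) + n
      ≡⟨ cong₂ _+_ (sum-map-cong-∈ S (lookup (m -ᵉ numExp n k)) (λ i → lookup m i ∸ 1) λ i i∈S →
           trans (lookup--ᵉ m (numExp n k) i) (cong (lookup m i ∸_) (lookup-numExp-≢ (∈S⇒≢ i∈S)))) (sym length-S) ⟩
    NLA.sum (L.map (λ i → lookup m i ∸ 1) S) + suc (L.length S)
      ≡⟨ ℕP.+-suc _ (L.length S) ⟩
    suc (NLA.sum (L.map (λ i → lookup m i ∸ 1) S) + L.length S)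
      ≡⟨ cong suc (sum-map-∸1 (lookup m) S (λ i _ → pos i)) ⟩
    suc (sumExcept m k) ∎
    where open ≡-Reasoning

  KthTermSupport : Exp n → Set
  KthTermSupport m = (numExp n k ≤ᵉ m) × (coordSum S (m -ᵉ numExp n k) ≤ lookup (m -ᵉ numExp n k) k)

  support⇒FailsAt : ∀ m → KthTermSupport m → FailsAt m k
  support⇒FailsAt m (nE≤m , below) = (λ i → subst (_≤ lookup m i) (sym (lookup-ones i)) (pos i)) , (begin
    suc (sumExcept m k)                                ≡⟨ coordSum-m-numExp m pos ⟨
    coordSum S (m -ᵉ numExp n k) + n                   ≤⟨ ℕP.+-monoˡ-≤ n below ⟩
    lookup (m -ᵉ numExp n k) k + n                     ≡⟨ cong (_+ n) (lookup--ᵉ m (numExp n k) k) ⟩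
    lookup m k ∸ lookup (numExp n k) k + n             ≡⟨ cong (λ x → lookup m k ∸ x + n) lookup-numExp-k ⟩
    lookup m k ∸ n + n                                 ≡⟨ ℕP.m∸n+n≡m n≤mₖ ⟩
    lookup m k                                         ∎)
    where
    open ℕP.≤-Reasoning
    n≤mₖ : n ≤ lookup m k
    n≤mₖ = subst (_≤ lookup m k) lookup-numExp-k (nE≤m k)
    pos : ∀ i → 1 ≤ lookup m i
    pos i with i FinP.≟ k
    ... | yes refl = ℕP.≤-trans (subst (1 ≤_) length-S (s≤s z≤n)) n≤mₖ
    ... | no i≢k   = subst (_≤ lookup m i) (lookup-numExp-≢ i≢k) (nE≤m i)

  FailsAt⇒support : ∀ m → FailsAt m k → KthTermSupport m
  FailsAt⇒support m (ones≤m , σ<mₖ) = nE≤m , (begin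
    coordSum S (m -ᵉ numExp n k)                       ≡⟨ ℕP.m+n∸n≡m _ n ⟨
    coordSum S (m -ᵉ numExp n k) + n ∸ n               ≤⟨ ℕP.∸-monoˡ-≤ n shifted+n≤mₖ ⟩
    lookup m k ∸ n                                     ≡⟨ cong (lookup m k ∸_) lookup-numExp-k ⟨
    lookup m k ∸ lookup (numExp n k) k                 ≡⟨ lookup--ᵉ m (numExp n k) k ⟨
    lookup (m -ᵉ numExp n k) k                         ∎)
    where
    open ℕP.≤-Reasoning
    pos : ∀ i → 1 ≤ lookup m i
    pos i = subst (_≤ lookup m i) (lookup-ones i) (ones≤m i)
    shifted+n≤mₖ : coordSum S (m -ᵉ numExp n k) + n ≤ lookup m k
    shifted+n≤mₖ = subst (_≤ lookup m k) (sym (coordSum-m-numExp m pos)) σ<mₖ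
    nE≤m : numExp n k ≤ᵉ m
    nE≤m i with i FinP.≟ k
    ... | yes refl = subst (_≤ lookup m k) (sym lookup-numExp-k) (ℕP.≤-trans (ℕP.m≤n+m n _) shifted+n≤mₖ)
    ... | no i≢k   = subst (_≤ lookup m i) (sym (lookup-numExp-≢ i≢k)) (pos i)

  kTerm-coeff : ∀ m → kTerm n k m ≡ guard (FailsAt? m k) 1ℤ
  kTerm-coeff m = begin
    kTerm n k m
      ≡⟨ mono-⋆ (numExp n k) (geom (unit k) ⋆ geomProduct (unit k) S) m ⟩
    guard (numExp n k ≤ᵉ? m) ((geom (unit k) ⋆ geomProduct (unit k) S) (m -ᵉ numExp n k))
      ≡⟨ cong (guard (numExp n k ≤ᵉ? m)) (denominator-coeff (m -ᵉ numExp n k)) ⟩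
    guard (numExp n k ≤ᵉ? m) (guard (below? (m -ᵉ numExp n k)) 1ℤ)
      ≡⟨ guard-× (numExp n k ≤ᵉ? m) (below? (m -ᵉ numExp n k)) ⟩
    guard ((numExp n k ≤ᵉ? m) ×-dec below? (m -ᵉ numExp n k)) 1ℤ
      ≡⟨ guard-⇔ ((numExp n k ≤ᵉ? m) ×-dec below? (m -ᵉ numExp n k)) (FailsAt? m k)
           (support⇒FailsAt m) (FailsAt⇒support m) ⟩
    guard (FailsAt? m k) 1ℤ ∎
    where
    open ≡-Reasoning
    below? : ∀ a → Dec (coordSum S a ≤ lookup a k)
    below? a = coordSum S a ℕP.≤? lookup a k

∈⇒≤sum-map : ∀ {A : Set} (f : A → ℕ) {x xs} → x ∈ xs → f x ≤ NLA.sum (L.map f xs)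
∈⇒≤sum-map f (here refl) = ℕP.m≤m+n _ _
∈⇒≤sum-map f {xs = y ∷ _} (there x∈xs) = ℕP.≤-trans (∈⇒≤sum-map f x∈xs) (ℕP.m≤n+m _ (f y))

lookup≤sumExcept : ∀ {n} (m : Exp n) {i k} → i ≢ k → lookup m i ≤ sumExcept m k
lookup≤sumExcept {n} m {k = k} i≢k = ∈⇒≤sum-map (lookup m) (KthTerm.≢⇒∈S n k i≢k)

inequalityFails-unique : ∀ {n} (m : Exp n) {k k′} → sumExcept m k < lookup m k → sumExcept m k′ < lookup m k′ → k ≡ k′
inequalityFails-unique m {k} {k′} fails fails′ with k FinP.≟ k′
... | yes k≡k′ = k≡k′
... | no k≢k′  = ⊥-elim (ℕP.<-irrefl refl (begin-strict
  lookup m k′     ≤⟨ lookup≤sumExcept m (k≢k′ ∘ sym) ⟩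
  sumExcept m k   <⟨ fails ⟩
  lookup m k      ≤⟨ lookup≤sumExcept m k≢k′ ⟩
  sumExcept m k′  <⟨ fails′ ⟩
  lookup m k′     ∎))
  where open ℕP.≤-Reasoning

lhsSeries-coeff : ∀ n m → lhsSeries n m ≡
  guard (ones n ≤ᵉ? m) 1ℤ -ℤ ∑ (L.allFin n) (λ k → guard (FailsAt? m k) 1ℤ)
lhsSeries-coeff n m = split (ones n ≤ᵉ? m) (FinP.any? (λ k → sumExcept m k ℕP.<? lookup m k))
  where
  open ≡-Reasoning
  split : (positive? : Dec (ones n ≤ᵉ m)) → Dec (∃ λ k → sumExcept m k < lookup m k) →
          guard (InK? m) 1ℤ ≡ guard positive? 1ℤ -ℤ ∑ (L.allFin n) (λ k → guard (FailsAt? m k) 1ℤ)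
  split (no ¬ones≤m) _ = begin
    guard (InK? m) 1ℤ
      ≡⟨ guard-no (InK? m) (λ m∈K → ¬ones≤m (λ i → subst (_≤ lookup m i) (sym (lookup-ones i)) (proj₁ (m∈K i)))) ⟩
    0ℤ -ℤ 0ℤ
      ≡⟨ cong (0ℤ -ℤ_) (∑-zeros (L.allFin n) (λ k → guard-no (FailsAt? m k) (¬ones≤m ∘ proj₁))) ⟨
    0ℤ -ℤ ∑ (L.allFin n) (λ k → guard (FailsAt? m k) 1ℤ) ∎
  split (yes ones≤m) (yes (k₀ , fails₀)) = begin
    guard (InK? m) 1ℤ
      ≡⟨ guard-no (InK? m) (λ m∈K → ℕP.<⇒≱ fails₀ (proj₂ (m∈K k₀))) ⟩
    1ℤ -ℤ 1ℤ
      ≡⟨ cong (1ℤ -ℤ_) (trans (∑-cong (L.allFin n) only-k₀) (∑-allFin-delta n k₀ (λ _ → 1ℤ))) ⟨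
    1ℤ -ℤ ∑ (L.allFin n) (λ k → guard (FailsAt? m k) 1ℤ) ∎
    where
    only-k₀ : ∀ k → guard (FailsAt? m k) 1ℤ ≡ guard (k FinP.≟ k₀) 1ℤ
    only-k₀ k = guard-⇔ (FailsAt? m k) (k FinP.≟ k₀)
      (λ (_ , fails) → inequalityFails-unique m fails fails₀) (λ { refl → ones≤m , fails₀ })
  split (yes ones≤m) (no ¬fails) = begin
    guard (InK? m) 1ℤ
      ≡⟨ guard-yes (InK? m) (λ j → subst (_≤ lookup m j) (lookup-ones j) (ones≤m j) , ℕP.≮⇒≥ (λ fails → ¬fails (j , fails))) ⟩
    1ℤ -ℤ 0ℤ
      ≡⟨ cong (1ℤ -ℤ_) (∑-zeros (L.allFin n) (λ k → guard-no (FailsAt? m k) (λ (_ , fails) → ¬fails (k , fails)))) ⟨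
    1ℤ -ℤ ∑ (L.allFin n) (λ k → guard (FailsAt? m k) 1ℤ) ∎

sumPS-apply : ∀ {n} (fs : List (PS n)) m → sumPS fs m ≡ ∑ fs (λ f → f m)
sumPS-apply []       m = refl
sumPS-apply (f ∷ fs) m = cong (f m +ℤ_) (sumPS-apply fs m)

-- The identity holds for n = 0 as well (both sides are 1).
mainTheorem2 : (n : ℕ) → 1 ≤ n → (m : Exp n) → lhsSeries n m ≡ rhsSeries n m
mainTheorem2 n _ m = begin
  lhsSeries n m
    ≡⟨ lhsSeries-coeff n m ⟩
  guard (ones n ≤ᵉ? m) 1ℤ -ℤ ∑ (L.allFin n) (λ k → guard (FailsAt? m k) 1ℤ)
    ≡⟨ cong₂ _-ℤ_ (firstTerm-coeff n m) kTerms ⟨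
  firstTerm n m -ℤ sumPS (L.map (kTerm n) (L.allFin n)) m ∎
  where
  open ≡-Reasoning
  kTerms : sumPS (L.map (kTerm n) (L.allFin n)) m
         ≡ ∑ (L.allFin n) (λ k → guard (FailsAt? m k) 1ℤ)
  kTerms = begin
    sumPS (L.map (kTerm n) (L.allFin n)) m    ≡⟨ sumPS-apply (L.map (kTerm n) (L.allFin n)) m ⟩
    ∑ (L.map (kTerm n) (L.allFin n)) (λ f → f m) ≡⟨ ∑-map (L.allFin n) (kTerm n) (λ f → f m) ⟩
    ∑ (L.allFin n) (λ k → kTerm n k m)         ≡⟨ ∑-cong (L.allFin n) (λ k → KthTerm.kTerm-coeff n k m) ⟩
    ∑ (L.allFin n) (λ k → guard (FailsAt? m k) 1ℤ) ∎
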